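{- Let $r\ge 2$ and $F=\begin{bmatrix}1&1\\1&1\\0&1\end{bmatrix}$. Then $\mathrm{forb}(m,r,\mathrm{Sym}(F))=\Theta(m^{2(r-1)})$.
   Context: An $r$-matrix is a matrix with entries in $\{0,1,\dots,r-1\}$; a matrix is simple if it has no repeated columns. $F\prec A$ means some submatrix of $A$ is a row and column permutation of $F$. $\mathrm{forb}(m,r,\mathcal F)$ is the maximum number of columns of a simple $m$-rowed $r$-matrix $A$ with $F\not\prec A$ for all $F\in\mathcal F$. For a $(0,1)$-matrix $F$, $F(i,j)$ replaces each $0$ by $i$ and each $1$ by $j$; $\mathrm{Sym}(F)=\{F(i,j):0\le i<j\le r-1\}$. Asymptotics are as $m\to\infty$ with $r$ fixed. -}

module Defs where

open import Data.Nat using (ℕ; _<_; _≤_; _*_; _^_; _∸_)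
open import Data.Fin using (Fin; toℕ)
open import Data.Bool using (Bool; true; false; if_then_else_)
open import Data.Product using (Σ; _×_; ∃-syntax)
open import Relation.Binary.PropositionalEquality using (_≡_)
open import Relation.Nullary using (¬_)
open import Function.Definitions using (Injective)

Matrix : ℕ → ℕ → ℕ → Set
Matrix m n r = Fin m → Fin n → Fin r

Simple : ∀ {m n r} → Matrix m n r → Set
Simple {m} {n} A = ∀ (j j' : Fin n) → (∀ (i : Fin m) → A i j ≡ A i j') → j ≡ j'

-- F ≺ A: some submatrix of A is a row and column permutation of F,
-- i.e. there are injective row and column maps realising F inside A.
_≺_ : ∀ {p q m n r} → Matrix p q r → Matrix m n r → Set
_≺_ {p} {q} {m} {n} F A =
  Σ (Fin p → Fin m) λ ρ → Σ (Fin q → Fin n) λ κ →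
    Injective _≡_ _≡_ ρ × Injective _≡_ _≡_ κ ×
    (∀ (i : Fin p) (j : Fin q) → F i j ≡ A (ρ i) (κ j))

-- Instantiate a (0,1)-matrix (entries Bool, false = 0, true = 1) as F(i,j).
inst : ∀ {p q r} → (Fin p → Fin q → Bool) → Fin r → Fin r → Matrix p q r
inst F a b x y = if F x y then b else a

-- A avoids every member of Sym(F) = { F(a,b) : 0 ≤ a < b ≤ r-1 }.
AvoidsSym : ∀ {p q m n r} → (Fin p → Fin q → Bool) → Matrix m n r → Set
AvoidsSym {r = r} F A = ∀ (a b : Fin r) → toℕ a < toℕ b → ¬ (inst F a b ≺ A)

-- IsForb m r F k : k = forb(m, r, Sym(F)), i.e. k is the maximum number of
-- columns of a simple m-rowed r-matrix avoiding Sym(F).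
IsForb : ∀ {p q} → ℕ → ℕ → (Fin p → Fin q → Bool) → ℕ → Set
IsForb m r F k =
  (Σ (Matrix m k r) λ A → Simple A × AvoidsSym F A) ×
  (∀ (n : ℕ) (A : Matrix m n r) → Simple A → AvoidsSym F A → n ≤ k)

F3 : Fin 3 → Fin 2 → Bool
F3 Fin.zero _ = true
F3 (Fin.suc Fin.zero) _ = true
F3 (Fin.suc (Fin.suc Fin.zero)) Fin.zero = false
F3 (Fin.suc (Fin.suc Fin.zero)) (Fin.suc Fin.zero) = true

module Submission where

open import Defs
open import Data.Nat using (ℕ; _≤_; _*_; _^_; _∸_)
open import Data.Product using (Σ; _×_; ∃-syntax)

-- Upper bound.  For a column c and a nonzero symbol b record two rows of c
-- reading b (when they exist).  If two columns u, v of a Sym(F3)-avoiding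
-- matrix record the same rows for every nonzero b, they are equal: were some
-- row z to read b in u and a smaller symbol a in v, the two rows recorded for
-- b together with z would carry F3(a, b) in the columns v, u.  So columns of a
-- simple avoiding matrix are determined by 2(r-1) optional rows, and there are
-- at most (m+1)^(2(r-1)) of them.
--
-- Lower bound.  Split B·2(r-1) ≤ m rows into blocks of B rows, one block for
-- each of the two copies of each nonzero symbol.  For every way of choosing one
-- row in each block there is a column carrying the symbol in the two chosen rows
-- of its blocks and 0 elsewhere.  These B^(2(r-1)) columns are distinct, and no
-- nonzero symbol occurs three times in a column, so no F3(a, b) with a < b fits.
--
-- Every property involved is decidable over finite sets, so forb
-- exists: admissibility of a width is decided by exhaustive search over the
-- searchable space of matrices, and forb is the largest admissible width below
-- any known bound (forb-between).

open import Data.Nat using (zero; suc; z≤n; s≤s; NonZero; _+_; _<_)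
import Data.Nat.Properties as ℕₚ
open import Data.Nat.DivMod using (_/_; _%_; m/n*n≤m; m≡m%n+[m/n]*n; m%n<n; m≥n⇒m/n>0)
open import Data.Nat.Tactic.RingSolver using (solve-∀)
open import Data.Fin using (Fin; zero; suc; toℕ; splitAt; join; _↑ˡ_; combine; funToFin; finToFun)
open import Data.Fin.Patterns using (0F; 1F; 2F)
import Data.Fin.Properties as Finₚ
open import Data.Fin.Properties using (any?; all?; *↔×)
open import Data.Vec.Functional using ([]; _∷_; head; tail)
open import Data.Vec.Functional.Relation.Binary.Pointwise using (Pointwise)
open import Data.Bool using (Bool; if_then_else_)
open import Data.Maybe using (Maybe; just; nothing; maybe)
import Data.Maybe.Properties as Maybeₚ
open import Data.Product using (∃; _,_; proj₁; proj₂)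
open import Data.Product.Function.NonDependent.Propositional using (_×-↔_)
open import Data.Sum using (inj₁; [_,_]′)
open import Function using (_∘_; const)
open import Function.Bundles using (_↔_; Inverse)
open import Function.Construct.Composition using (_↔-∘_)
open import Function.Construct.Identity using (↔-id)
open import Function.Definitions using (Injective)
open import Relation.Binary using (tri<; tri≈; tri>)
open import Relation.Binary.PropositionalEquality
open import Relation.Nullary using (Dec; yes; no; ¬_; ¬?; does; contradiction)
open import Relation.Nullary.Decidable using (map′; _×-dec_; _→-dec_; dec-true)
import Algebra.Properties.CommutativeSemigroup ℕₚ.*-commutativeSemigroup as *-Semigroup

private variable
  k m n p q r r' : ℕ

Searchable : (A : Set) → (A → A → Set) → Set₁
Searchable A _≈_ =
  (P : A → Set) → (∀ {x y} → x ≈ y → P x → P y) → (∀ x → Dec (P x)) → Dec (∃ P)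

Fin-searchable : Searchable (Fin n) _≡_
Fin-searchable P _ P? = any? P?

-- Tuples over a searchable type are searchable modulo pointwise relatedness:
-- search for a head admitting a suitable tail.
tuples-searchable : {A : Set} {_≈_ : A → A → Set} → (∀ {x} → x ≈ x) →
  Searchable A _≈_ → ∀ k → Searchable (Fin k → A) (Pointwise _≈_)
tuples-searchable refl≈ search zero P resp P? =
  map′ ([] ,_) (λ (f , p) → resp (λ ()) p) (P? [])
tuples-searchable refl≈ search (suc k) P resp P? =
  map′ (λ (a , g , p) → a ∷ g , p)
       (λ (f , p) → head f , tail f , resp (λ { 0F → refl≈ ; (suc i) → refl≈ }) p)
       (search (λ a → ∃ λ g → P (a ∷ g))
          (λ a≈b (g , p) → g , resp (λ { 0F → a≈b ; (suc i) → refl≈ }) p)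
          (λ a → tuples-searchable refl≈ search k (λ g → P (a ∷ g))
                   (λ g≈h → resp (λ { 0F → refl≈ ; (suc i) → g≈h i }))
                   (λ g → P? (a ∷ g))))

maps-searchable : ∀ k → Searchable (Fin k → Fin n) (Pointwise _≡_)
maps-searchable = tuples-searchable refl Fin-searchable

matrices-searchable : Searchable (Matrix m n r) (Pointwise (Pointwise _≡_))
matrices-searchable {m} {n} = tuples-searchable (λ _ → refl) (maps-searchable n) m

injective? : (f : Fin k → Fin n) → Dec (Injective _≡_ _≡_ f)
injective? f = map′ (λ inj {x} {y} → inj x y) (λ inj x y → inj)
  (all? λ x → all? λ y → (f x Finₚ.≟ f y) →-dec (x Finₚ.≟ y))

injective-resp : {f g : Fin k → Fin n} → Pointwise _≡_ f g →
  Injective _≡_ _≡_ f → Injective _≡_ _≡_ g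
injective-resp f≗g f-inj {x} {y} gx≡gy = f-inj (trans (f≗g x) (trans gx≡gy (sym (f≗g y))))

Embedding : Matrix p q r → Matrix m n r → (Fin p → Fin m) → (Fin q → Fin n) → Set
Embedding F A ρ κ =
  Injective _≡_ _≡_ ρ × Injective _≡_ _≡_ κ × (∀ i j → F i j ≡ A (ρ i) (κ j))

≺? : (F : Matrix p q r) (A : Matrix m n r) → Dec (F ≺ A)
≺? {p} {q} F A =
  maps-searchable p (λ ρ → ∃ (Embedding F A ρ))
    (λ ρ≗ρ' (κ , ρ-inj , κ-inj , entries) → κ , injective-resp ρ≗ρ' ρ-inj , κ-inj ,
       λ i j → trans (entries i j) (cong (λ x → A x (κ j)) (ρ≗ρ' i)))
    λ ρ → maps-searchable q (Embedding F A ρ)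
      (λ κ≗κ' (ρ-inj , κ-inj , entries) → ρ-inj , injective-resp κ≗κ' κ-inj ,
         λ i j → trans (entries i j) (cong (A (ρ i)) (κ≗κ' j)))
      λ κ → injective? ρ ×-dec injective? κ ×-dec
              all? λ i → all? λ j → F i j Finₚ.≟ A (ρ i) (κ j)

simple? : (A : Matrix m n r) → Dec (Simple A)
simple? A = all? λ j → all? λ j' → all? (λ i → A i j Finₚ.≟ A i j') →-dec (j Finₚ.≟ j')

avoidsSym? : (F : Fin p → Fin q → Bool) (A : Matrix m n r) → Dec (AvoidsSym F A)
avoidsSym? F A = all? λ a → all? λ b → (toℕ a ℕₚ.<? toℕ b) →-dec ¬? (≺? (inst F a b) A)

Admissible : ℕ → ℕ → (Fin p → Fin q → Bool) → ℕ → Set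
Admissible m r F n = Σ (Matrix m n r) λ A → Simple A × AvoidsSym F A

admissible? : (F : Fin p → Fin q → Bool) → ∀ n → Dec (Admissible m r F n)
admissible? F n = matrices-searchable (λ A → Simple A × AvoidsSym F A)
  (λ A≈B (simple , avoids) →
     (λ j j' same → simple j j' λ i → trans (A≈B i j) (trans (same i) (sym (A≈B i j')))) ,
     (λ a b a<b (ρ , κ , ρ-inj , κ-inj , entries) → avoids a b a<b
        (ρ , κ , ρ-inj , κ-inj , λ i j → trans (entries i j) (sym (A≈B (ρ i) (κ j))))))
  λ A → simple? A ×-dec avoidsSym? F A

largest : (P : ℕ → Set) → (∀ n → Dec (P n)) → ∀ {w} u → P w → (∀ n → P n → n ≤ u) →
  ∃ λ k → P k × (∀ n → P n → n ≤ k)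
largest P P? zero Pw bound = _ , Pw , λ n Pn → ℕₚ.≤-trans (bound n Pn) z≤n
largest P P? (suc u) Pw bound with P? (suc u)
... | yes Pu = suc u , Pu , bound
... | no ¬Pu = largest P P? u Pw λ n Pn →
  ℕₚ.m<1+n⇒m≤n (ℕₚ.≤∧≢⇒< (bound n Pn) λ { refl → ¬Pu Pn })

forb-between : (F : Fin p → Fin q → Bool) (L U : ℕ) → Admissible m r F L →
  (∀ n → Admissible m r F n → n ≤ U) → ∃ λ k → IsForb m r F k × L ≤ k × k ≤ U
forb-between F L U admissible bound
  with k , admissibleₖ , maximal ← largest _ (admissible? F) U admissible bound =
  k , (admissibleₖ , λ n A simple avoids → maximal n (A , simple , avoids)) ,
  maximal L admissible , bound k admissibleₖ

funToFin-cong : {f g : Fin k → Fin n} → Pointwise _≡_ f g → funToFin f ≡ funToFin g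
funToFin-cong {k = zero} f≗g = refl
funToFin-cong {k = suc k} f≗g = cong₂ combine (f≗g 0F) (funToFin-cong (f≗g ∘ suc))

module Tabulation {T : Set} (enumeration : Fin k ↔ T) where
  open Inverse enumeration

  tabulate : (T → Fin n) → Fin (n ^ k)
  tabulate f = funToFin (f ∘ to)

  untabulate : Fin (n ^ k) → T → Fin n
  untabulate x = finToFun x ∘ from

  tabulate-injective : {f g : T → Fin n} → tabulate f ≡ tabulate g → ∀ t → f t ≡ g t
  tabulate-injective {f = f} {g} same t = begin
    f t                            ≡⟨ cong f (strictlyInverseˡ t) ⟨
    f (to (from t))                ≡⟨ Finₚ.finToFun-funToFin (f ∘ to) (from t) ⟨
    finToFun (tabulate f) (from t) ≡⟨ cong (λ x → finToFun x (from t)) same ⟩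
    finToFun (tabulate g) (from t) ≡⟨ Finₚ.finToFun-funToFin (g ∘ to) (from t) ⟩
    g (to (from t))                ≡⟨ cong g (strictlyInverseˡ t) ⟩
    g t                            ∎
    where open ≡-Reasoning

  untabulate-injective : {x y : Fin (n ^ k)} → (∀ t → untabulate x t ≡ untabulate y t) → x ≡ y
  untabulate-injective {n = n} {x = x} {y} same = begin
    x                                   ≡⟨ Finₚ.funToFin-finToFin {k} {n} x ⟨
    funToFin (finToFun {n} {k} x)       ≡⟨ funToFin-cong digits ⟩
    funToFin (finToFun {n} {k} y)       ≡⟨ Finₚ.funToFin-finToFin {k} {n} y ⟩
    y                                   ∎
    where
    open ≡-Reasoning
    digits : ∀ i → finToFun {n} {k} x i ≡ finToFun y i
    digits i = begin
      finToFun {n} {k} x i        ≡⟨ cong (finToFun x) (strictlyInverseʳ i) ⟨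
      untabulate x (to i)         ≡⟨ same (to i) ⟩
      untabulate y (to i)         ≡⟨ cong (finToFun y) (strictlyInverseʳ i) ⟩
      finToFun y i                ∎

three-distinct : {x y z : Fin m} → x ≢ y → x ≢ z → y ≢ z → Injective _≡_ _≡_ (x ∷ y ∷ z ∷ [])
three-distinct x≢y x≢z y≢z {0F} {0F} _ = refl
three-distinct x≢y x≢z y≢z {0F} {1F} e = contradiction e x≢y
three-distinct x≢y x≢z y≢z {0F} {2F} e = contradiction e x≢z
three-distinct x≢y x≢z y≢z {1F} {0F} e = contradiction (sym e) x≢y
three-distinct x≢y x≢z y≢z {1F} {1F} _ = refl
three-distinct x≢y x≢z y≢z {1F} {2F} e = contradiction e y≢z
three-distinct x≢y x≢z y≢z {2F} {0F} e = contradiction (sym e) x≢z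
three-distinct x≢y x≢z y≢z {2F} {1F} e = contradiction (sym e) y≢z
three-distinct x≢y x≢z y≢z {2F} {2F} _ = refl

two-distinct : {x y : Fin n} → x ≢ y → Injective _≡_ _≡_ (x ∷ y ∷ [])
two-distinct x≢y {0F} {0F} _ = refl
two-distinct x≢y {0F} {1F} e = contradiction e x≢y
two-distinct x≢y {1F} {0F} e = contradiction (sym e) x≢y
two-distinct x≢y {1F} {1F} _ = refl

F3-occurrence : (A : Matrix m n r) {x₁ x₂ z : Fin m} {v u : Fin n} {b : Fin r} →
  x₁ ≢ x₂ → x₁ ≢ z → x₂ ≢ z → v ≢ u →
  A x₁ v ≡ b → A x₁ u ≡ b → A x₂ v ≡ b → A x₂ u ≡ b → A z u ≡ b →
  inst F3 (A z v) b ≺ A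
F3-occurrence A {x₁} {x₂} {z} {v} {u} x₁≢x₂ x₁≢z x₂≢z v≢u x₁v x₁u x₂v x₂u zu =
  x₁ ∷ x₂ ∷ z ∷ [] , v ∷ u ∷ [] ,
  three-distinct x₁≢x₂ x₁≢z x₂≢z , two-distinct v≢u , entries
  where
  entries : ∀ i j → inst F3 (A z v) _ i j ≡ A ((x₁ ∷ x₂ ∷ z ∷ []) i) ((v ∷ u ∷ []) j)
  entries 0F 0F = sym x₁v
  entries 0F 1F = sym x₁u
  entries 1F 0F = sym x₂v
  entries 1F 1F = sym x₂u
  entries 2F 0F = refl
  entries 2F 1F = sym zu

AtMostTwice : Matrix m n (suc r') → Set
AtMostTwice {m} A = ∀ x j (rows : Fin 3 → Fin m) →
  (∀ k → A (rows k) x ≡ suc j) → ¬ Injective _≡_ _≡_ rows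

-- The second column of F3(a, b) with a < b reads b ≠ 0 in three distinct rows.
at-most-twice⇒avoids : (A : Matrix m n (suc r')) → AtMostTwice A → AvoidsSym F3 A
at-most-twice⇒avoids A twice a zero a<0 _ = ℕₚ.n≮0 a<0
at-most-twice⇒avoids A twice a (suc j) _ (ρ , κ , ρ-inj , _ , entries) =
  twice (κ 1F) j ρ (λ { 0F → sym (entries 0F 1F)
                      ; 1F → sym (entries 1F 1F)
                      ; 2F → sym (entries 2F 1F) }) ρ-inj

someRow : {P : Fin m → Set} → (∀ i → Dec (P i)) → Maybe (Fin m)
someRow P? with any? P?
... | yes (i , _) = just i
... | no _ = nothing

someRow-sound : {P : Fin m → Set} (P? : ∀ i → Dec (P i)) {i : Fin m} →
  someRow P? ≡ just i → P i
someRow-sound P? found with any? P?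
someRow-sound P? refl | yes (_ , Pi) = Pi

someRow-complete : {P : Fin m → Set} (P? : ∀ i → Dec (P i)) {z : Fin m} →
  P z → ∃ λ i → someRow P? ≡ just i
someRow-complete P? Pz with any? P?
... | yes (i , _) = i , refl
... | no none = contradiction (_ , Pz) none

reads? : (c : Fin m → Fin r) (b : Fin r) → ∀ i → Dec (c i ≡ b)
reads? c b i = c i Finₚ.≟ b

firstRow : (Fin m → Fin r) → Fin r → Maybe (Fin m)
firstRow c b = someRow (reads? c b)

OtherRow : (Fin m → Fin r) → Fin r → Fin m → Set
OtherRow c b i = c i ≡ b × firstRow c b ≢ just i

other? : (c : Fin m → Fin r) (b : Fin r) → ∀ i → Dec (OtherRow c b i)
other? c b i = reads? c b i ×-dec ¬? (Maybeₚ.≡-dec Finₚ._≟_ (firstRow c b) (just i))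

secondRow : (Fin m → Fin r) → Fin r → Maybe (Fin m)
secondRow c b = someRow (other? c b)

column : Matrix m n r → Fin n → Fin m → Fin r
column A u i = A i u

AgreeOn : Matrix m n r → Fin r → Fin n → Fin n → Set
AgreeOn A b u v = firstRow (column A u) b ≡ firstRow (column A v) b ×
                  secondRow (column A u) b ≡ secondRow (column A v) b

-- In a Sym(F3)-avoiding matrix, if columns u, v agree on b and row z reads b in
-- column u, then row z does not read a smaller symbol in column v: otherwise
-- the recorded rows x₁, x₂ and z carry F3(A z v, b) in the columns v, u.
agree⇒not-smaller : (A : Matrix m n r) → AvoidsSym F3 A → {b : Fin r} {u v : Fin n} →
  AgreeOn A b u v → ∀ {z} → A z u ≡ b → ¬ toℕ (A z v) < toℕ b
agree⇒not-smaller A avoids {b} {u} {v} (same₁ , same₂) {z} zu zv<b =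
  let -- the first recorded row x₁ reads b in both columns
      x₁ , first-u = someRow-complete (reads? (column A u) b) zu
      x₁u = someRow-sound (reads? (column A u) b) first-u
      x₁v = someRow-sound (reads? (column A v) b) (trans (sym same₁) first-u)
      -- z ≠ x₁ reads b in u, so a second row x₂ ≠ x₁ is recorded, reading b in both
      z-other = zu , λ first≡z → ≢z x₁v (Maybeₚ.just-injective (trans (sym first-u) first≡z))
      x₂ , second-u = someRow-complete (other? (column A u) b) z-other
      x₂u , first≢x₂ = someRow-sound (other? (column A u) b) second-u
      x₂v , _ = someRow-sound (other? (column A v) b) (trans (sym same₂) second-u)
      x₁≢x₂ = λ x₁≡x₂ → first≢x₂ (trans first-u (cong just x₁≡x₂))
      v≢u = λ v≡u → ≢z (trans (cong (A z) v≡u) zu) refl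
  in avoids (A z v) b zv<b
       (F3-occurrence A x₁≢x₂ (≢z x₁v) (≢z x₂v) v≢u x₁v x₁u x₂v x₂u zu)
  where
  ≢z : ∀ {x} → A x v ≡ b → x ≢ z
  ≢z xv refl = ℕₚ.<-irrefl (cong toℕ xv) zv<b

recorded : (Fin m → Fin (suc r')) → Fin 2 × Fin r' → Maybe (Fin m)
recorded c (0F , j) = firstRow c (suc j)
recorded c (1F , j) = secondRow c (suc j)

optional : Maybe (Fin m) → Fin (suc m)
optional = maybe suc zero

optional-injective : {x y : Maybe (Fin m)} → optional x ≡ optional y → x ≡ y
optional-injective {x = nothing} {nothing} _ = refl
optional-injective {x = just i} {just i'} e = cong just (Finₚ.suc-injective e)

signature : (Fin m → Fin (suc r')) → Fin (suc m ^ (2 * r'))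
signature c = tabulate (optional ∘ recorded c)
  where open Tabulation *↔×

-- forb(m, r, Sym F3) ≤ (m+1)^(2(r-1)): in a simple Sym(F3)-avoiding matrix
-- distinct columns have distinct signatures.
upper-bound : (A : Matrix m n (suc r')) → Simple A → AvoidsSym F3 A → n ≤ suc m ^ (2 * r')
upper-bound A simple avoids = Finₚ.injective⇒≤ signature-injective
  where
  dominated : ∀ u v → (∀ j → AgreeOn A (suc j) u v) → ∀ z → ¬ toℕ (A z v) < toℕ (A z u)
  dominated u v agree z zv<zu with A z u in zu
  ... | zero = ℕₚ.n≮0 zv<zu
  ... | suc j = agree⇒not-smaller A avoids (agree j) zu zv<zu

  signature-injective : Injective _≡_ _≡_ (signature ∘ column A)
  signature-injective {u} {v} same = simple u v entries-equal
    where
    open Tabulation *↔×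
    recorded-same : ∀ t → recorded (column A u) t ≡ recorded (column A v) t
    recorded-same t = optional-injective (tabulate-injective same t)
    entries-equal : ∀ z → A z u ≡ A z v
    entries-equal z with Finₚ.<-cmp (A z u) (A z v)
    ... | tri< zu<zv _ _ = contradiction zu<zv
            (dominated v u (λ j → sym (recorded-same (0F , j)) , sym (recorded-same (1F , j))) z)
    ... | tri≈ _ zu≡zv _ = zu≡zv
    ... | tri> _ _ zv<zu = contradiction zv<zu
            (dominated u v (λ j → recorded-same (0F , j) , recorded-same (1F , j)) z)

record RowLabelling (T : Set) (m : ℕ) : Set where
  field
    label          : Fin m → Maybe T
    rowOf          : T → Fin m
    rowOf-labelled : ∀ t → label (rowOf t) ≡ just t
    labelled-row   : ∀ {i t} → label i ≡ just t → i ≡ rowOf t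

row-labelling : {T : Set} → Fin n ↔ T → n ≤ m → RowLabelling T m
row-labelling {n} {T = T} enumeration n≤m with o , refl ← ℕₚ.m≤n⇒∃[o]m+o≡n n≤m = record
  { label          = label
  ; rowOf          = λ t → from t ↑ˡ o
  ; rowOf-labelled = λ t → trans (cong [ just ∘ to , const nothing ]′ (Finₚ.splitAt-↑ˡ n (from t) o))
                                 (cong just (strictlyInverseˡ t))
  ; labelled-row   = labelled-row
  }
  where
  open Inverse enumeration
  label : Fin (n + o) → Maybe T
  label = [ just ∘ to , const nothing ]′ ∘ splitAt n
  labelled-row : ∀ {i t} → label i ≡ just t → i ≡ from t ↑ˡ o
  labelled-row {i} labelled with splitAt n i in split
  labelled-row {i} refl | inj₁ a = begin
    i                 ≡⟨ Finₚ.join-splitAt n o i ⟨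
    join n o (splitAt n i) ≡⟨ cong (join n o) split ⟩
    a ↑ˡ o            ≡⟨ cong (_↑ˡ o) (strictlyInverseʳ a) ⟨
    from (to a) ↑ˡ o  ∎
    where open ≡-Reasoning

-- Rows are labelled by (w, (s, j)): the w-th row of the block for copy s of the
-- symbol j+1.  Column x places copy s of j+1 in the row of its block selected by
-- placement x (s, j), and has 0 everywhere else.
module Design {r' B m : ℕ} (labelling : RowLabelling (Fin B × (Fin 2 × Fin r')) m) where
  open RowLabelling labelling
  open Tabulation (*↔× {2} {r'})

  Width : ℕ
  Width = B ^ (2 * r')

  placement : Fin Width → Fin 2 × Fin r' → Fin B
  placement = untabulate

  entry : Fin Width → Maybe (Fin B × (Fin 2 × Fin r')) → Fin (suc r')
  entry x (just (w , s , j)) = if does (placement x (s , j) Finₚ.≟ w) then suc j else zero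
  entry x nothing = zero

  design : Matrix m Width (suc r')
  design i x = entry x (label i)

  entry-placed : ∀ x s j → entry x (just (placement x (s , j) , s , j)) ≡ suc j
  entry-placed x s j rewrite dec-true (placement x (s , j) Finₚ.≟ placement x (s , j)) refl = refl

  entry-nonzero : ∀ x ℓ {j} → entry x ℓ ≡ suc j → ∃ λ s → ℓ ≡ just (placement x (s , j) , s , j)
  entry-nonzero x (just (w , s , j)) reads with placement x (s , j) Finₚ.≟ w
  entry-nonzero x (just (w , s , j)) refl | yes refl = s , refl

  entry-placement : ∀ x {w} s j → entry x (just (w , s , j)) ≡ suc j → placement x (s , j) ≡ w
  entry-placement x {w} s j reads with entry-nonzero x (just (w , s , j)) reads
  ... | _ , refl = refl

  -- the entries of column x in the rows it selects determine x
  design-simple : Simple design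
  design-simple x y same = untabulate-injective placement-same
    where
    open ≡-Reasoning
    placement-same : ∀ t → placement x t ≡ placement y t
    placement-same (s , j) = sym (entry-placement y s j (begin
      entry y (just (placement x (s , j) , s , j))
        ≡⟨ cong (entry y) (rowOf-labelled _) ⟨
      design (rowOf (placement x (s , j) , s , j)) y
        ≡⟨ same _ ⟨
      design (rowOf (placement x (s , j) , s , j)) x
        ≡⟨ cong (entry x) (rowOf-labelled _) ⟩
      entry x (just (placement x (s , j) , s , j))
        ≡⟨ entry-placed x s j ⟩
      suc j ∎))

  -- three distinct rows reading j+1 in column x would hold distinct copies of j+1
  design-at-most-twice : AtMostTwice design
  design-at-most-twice x j rows reads rows-injective =
    Finₚ.<⇒notInjective ℕₚ.≤-refl copy-injective
    where
    copy : Fin 3 → Fin 2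
    copy k = proj₁ (entry-nonzero x (label (rows k)) (reads k))
    row-of-copy : ∀ k → rows k ≡ rowOf (placement x (copy k , j) , copy k , j)
    row-of-copy k = labelled-row (proj₂ (entry-nonzero x (label (rows k)) (reads k)))
    copy-injective : Injective _≡_ _≡_ copy
    copy-injective {k} {k'} same = rows-injective (begin
      rows k                                  ≡⟨ row-of-copy k ⟩
      rowOf (placement x (copy k , j) , copy k , j)
        ≡⟨ cong (λ s → rowOf (placement x (s , j) , s , j)) same ⟩
      rowOf (placement x (copy k' , j) , copy k' , j) ≡⟨ row-of-copy k' ⟨
      rows k'                                 ∎)
      where open ≡-Reasoning

lower-bound : ∀ m B {r'} → B * (2 * r') ≤ m → Admissible m (suc r') F3 (B ^ (2 * r'))
lower-bound m B {r'} fits =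
  design , design-simple , at-most-twice⇒avoids design design-at-most-twice
  where open Design (row-labelling ((↔-id (Fin B) ×-↔ *↔× {2} {r'}) ↔-∘ *↔× {B}) fits)

^-distribʳ-* : ∀ x y k → (x * y) ^ k ≡ x ^ k * y ^ k
^-distribʳ-* x y zero = refl
^-distribʳ-* x y (suc k) = begin
  x * y * (x * y) ^ k       ≡⟨ cong (x * y *_) (^-distribʳ-* x y k) ⟩
  x * y * (x ^ k * y ^ k)   ≡⟨ *-Semigroup.interchange x y (x ^ k) (y ^ k) ⟩
  x * x ^ k * (y * y ^ k)   ∎
  where open ≡-Reasoning

m≤2d[m/d] : ∀ m d .{{_ : NonZero d}} → d ≤ m → m ≤ 2 * d * (m / d)
m≤2d[m/d] m d d≤m = begin
  m                      ≡⟨ m≡m%n+[m/n]*n m d ⟩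
  m % d + m / d * d      ≤⟨ ℕₚ.+-monoˡ-≤ _ (ℕₚ.<⇒≤ (m%n<n m d)) ⟩
  d + m / d * d          ≡⟨ cong (_+ m / d * d) (ℕₚ.*-identityˡ d) ⟨
  1 * d + m / d * d      ≤⟨ ℕₚ.+-monoˡ-≤ _ (ℕₚ.*-monoˡ-≤ d (m≥n⇒m/n>0 d≤m)) ⟩
  m / d * d + m / d * d  ≡⟨ double d (m / d) ⟩
  2 * d * (m / d)        ∎
  where
  open ℕₚ.≤-Reasoning
  double : ∀ d q → q * d + q * d ≡ 2 * d * q
  double = solve-∀

lower-estimate : ∀ m e .{{_ : NonZero e}} {k} → e ≤ m → (m / e) ^ e ≤ k → m ^ e ≤ (2 * e) ^ e * k
lower-estimate m e {k} e≤m L≤k = begin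
  m ^ e                     ≤⟨ ℕₚ.^-monoˡ-≤ e (m≤2d[m/d] m e e≤m) ⟩
  (2 * e * (m / e)) ^ e     ≡⟨ ^-distribʳ-* (2 * e) (m / e) e ⟩
  (2 * e) ^ e * (m / e) ^ e ≤⟨ ℕₚ.*-monoʳ-≤ ((2 * e) ^ e) L≤k ⟩
  (2 * e) ^ e * k           ∎
  where open ℕₚ.≤-Reasoning

suc^≤2^* : ∀ m e → 1 ≤ m → suc m ^ e ≤ 2 ^ e * m ^ e
suc^≤2^* m e 1≤m = ℕₚ.≤-trans (ℕₚ.^-monoˡ-≤ e suc≤2*)
  (ℕₚ.≤-reflexive (^-distribʳ-* 2 m e))
  where
  suc≤2* : suc m ≤ 2 * m
  suc≤2* = ℕₚ.≤-trans (ℕₚ.+-monoˡ-≤ m 1≤m) (ℕₚ.≤-reflexive (cong (m +_) (sym (ℕₚ.+-identityʳ m))))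

mainTheorem7 : ∀ (r : ℕ) → 2 ≤ r →
    ∃[ a ] ∃[ b ] ∃[ M ] (∀ (m : ℕ) → M ≤ m →
      ∃[ k ] (IsForb m r F3 k × m ^ (2 * (r ∸ 1)) ≤ a * k × k ≤ b * m ^ (2 * (r ∸ 1))))
mainTheorem7 (suc (suc r'')) (s≤s (s≤s z≤n)) = (2 * e) ^ e , 2 ^ e , e , bounds
  where
  -- the exponent 2(r-1), also used as the threshold for m and the block divisor
  e : ℕ
  e = 2 * suc r''
  bounds : ∀ m → e ≤ m →
    ∃[ k ] (IsForb m (suc (suc r'')) F3 k × m ^ e ≤ (2 * e) ^ e * k × k ≤ 2 ^ e * m ^ e)
  bounds m e≤m =
    let k , forb , L≤k , k≤U = forb-between F3 ((m / e) ^ e) (suc m ^ e)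
                                 (lower-bound m (m / e) (m/n*n≤m m e))
                                 (λ n (A , simple , avoids) → upper-bound A simple avoids)
    in k , forb , lower-estimate m e e≤m L≤k ,
       ℕₚ.≤-trans k≤U (suc^≤2^* m e (ℕₚ.≤-trans (s≤s z≤n) e≤m))
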